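{- Let $\mathbf{A}$ be a commutative bimonoid, let $\iota_1\colon\mathbf{A}\hookrightarrow\overline{\mathbf{A}}$ be a commutative complemented $\Delta_1$-extension of $\mathbf{A}$ (i.e.\ $\overline{\mathbf{A}}$ is complemented), and let $\iota\colon\mathbf{A}\hookrightarrow\mathbf{A}^{\Delta}$ be a commutative complemented Dedekind--MacNeille completion of $\mathbf{A}$. Then there is a unique ordinary Dedekind--MacNeille completion $\iota_2\colon\overline{\mathbf{A}}\hookrightarrow\mathbf{A}^{\Delta}$ such that $\iota=\iota_2\circ\iota_1$.
   Context: A bimonoid $\langle A,\leq,\cdot,1,+,0\rangle$ is a poset with two monoid structures ($\cdot$ with unit $1$, $+$ with unit $0$), both operations order preserving in each argument, satisfying hemidistributivity $x\cdot(y+z)\leq(x\cdot y)+z$ and $(z+y)\cdot x\leq z+(y\cdot x)$; commutative if both operations are commutative. Homomorphisms preserve order, $\cdot,1,+,0$; embeddings are homomorphisms that are order embeddings. In a commutative bimonoid, $y$ is a complement of $x$ if $x\cdot y\leq 0$ and $1\leq x+y$; it is unique if it exists, written $\overline{x}$; complemented means every element has a complement; complete means the order is a complete lattice. An embedding $e\colon\mathbf{A}\hookrightarrow\mathbf{C}$ of commutative bimonoids is a commutative $\Delta_1$-extension if the elements $e(a)\cdot\overline{e(b)}$ ($a,b\in\mathbf{A}$, complement existing in $\mathbf{C}$) are join dense in $\mathbf{C}$ and the elements $e(a)+\overline{e(b)}$ are meet dense in $\mathbf{C}$. A commutative complemented Dedekind--MacNeille completion is a commutative $\Delta_1$-extension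 $e\colon\mathbf{A}\hookrightarrow\mathbf{C}$ with $\mathbf{C}$ complete and complemented. An ordinary Dedekind--MacNeille completion is an embedding of bimonoids $j\colon\mathbf{B}\hookrightarrow\mathbf{C}$ whose image is both join dense and meet dense in $\mathbf{C}$. -}

module Defs where

open import Level using (Level; suc; _⊔_)
open import Data.Product using (Σ; ∃; _×_; _,_; Σ-syntax; ∃-syntax)
open import Relation.Binary.PropositionalEquality using (_≡_)
open import Relation.Binary.Structures using (IsPartialOrder)
open import Algebra.Structures using (IsCommutativeMonoid)

record CBimonoid (ℓ : Level) : Set (suc ℓ) where
  infixl 7 _·_
  infixl 6 _+_
  infix 4 _≤_
  field
    Carrier : Set ℓ
    _≤_     : Carrier → Carrier → Set ℓ
    _·_     : Carrier → Carrier → Carrier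
    _+_     : Carrier → Carrier → Carrier
    1#      : Carrier
    0#      : Carrier
    isPartialOrder : IsPartialOrder _≡_ _≤_
    ·-isCommutativeMonoid : IsCommutativeMonoid _≡_ _·_ 1#
    +-isCommutativeMonoid : IsCommutativeMonoid _≡_ _+_ 0#
    ·-monoˡ : ∀ {x x′} y → x ≤ x′ → x · y ≤ x′ · y
    ·-monoʳ : ∀ x {y y′} → y ≤ y′ → x · y ≤ x · y′
    +-monoˡ : ∀ {x x′} y → x ≤ x′ → x + y ≤ x′ + y
    +-monoʳ : ∀ x {y y′} → y ≤ y′ → x + y ≤ x + y′
    hemiˡ   : ∀ x y z → x · (y + z) ≤ (x · y) + z
    hemiʳ   : ∀ x y z → (z + y) · x ≤ z + (y · x)



module _ {ℓ : Level} (B : CBimonoid ℓ) where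
  open CBimonoid B

  IsComplement : Carrier → Carrier → Set ℓ
  IsComplement x y = (x · y ≤ 0#) × (1# ≤ x + y)

  Complemented : Set ℓ
  Complemented = ∀ x → ∃[ y ] IsComplement x y

  IsLUB : (Carrier → Set ℓ) → Carrier → Set ℓ
  IsLUB S s = (∀ x → S x → x ≤ s) × (∀ u → (∀ x → S x → x ≤ u) → s ≤ u)

  IsGLB : (Carrier → Set ℓ) → Carrier → Set ℓ
  IsGLB S s = (∀ x → S x → s ≤ x) × (∀ u → (∀ x → S x → u ≤ x) → u ≤ s)

  Complete : Set (suc ℓ)
  Complete = (∀ (S : Carrier → Set ℓ) → ∃[ s ] IsLUB S s)
           × (∀ (S : Carrier → Set ℓ) → ∃[ s ] IsGLB S s)

  JoinDense : (Carrier → Set ℓ) → Set (suc ℓ)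
  JoinDense D = ∀ c → Σ[ S ∈ (Carrier → Set ℓ) ] ((∀ x → S x → D x) × IsLUB S c)

  MeetDense : (Carrier → Set ℓ) → Set (suc ℓ)
  MeetDense D = ∀ c → Σ[ S ∈ (Carrier → Set ℓ) ] ((∀ x → S x → D x) × IsGLB S c)

record Embedding {ℓ : Level} (A C : CBimonoid ℓ) : Set ℓ where
  private
    module A = CBimonoid A
    module C = CBimonoid C
  field
    ⟦_⟧     : A.Carrier → C.Carrier
    mono    : ∀ {x y} → x A.≤ y → ⟦ x ⟧ C.≤ ⟦ y ⟧
    reflect : ∀ {x y} → ⟦ x ⟧ C.≤ ⟦ y ⟧ → x A.≤ y
    hom-·   : ∀ x y → ⟦ x A.· y ⟧ ≡ ⟦ x ⟧ C.· ⟦ y ⟧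
    hom-1   : ⟦ A.1# ⟧ ≡ C.1#
    hom-+   : ∀ x y → ⟦ x A.+ y ⟧ ≡ ⟦ x ⟧ C.+ ⟦ y ⟧
    hom-0   : ⟦ A.0# ⟧ ≡ C.0#

open Embedding public using (⟦_⟧)

module _ {ℓ : Level} {A C : CBimonoid ℓ} (e : Embedding A C) where
  private
    module C = CBimonoid C

  ΔJoinGen : C.Carrier → Set ℓ
  ΔJoinGen x = ∃[ a ] ∃[ b ] ∃[ y ] (IsComplement C (⟦ e ⟧ b) y × (x ≡ ⟦ e ⟧ a C.· y))

  ΔMeetGen : C.Carrier → Set ℓ
  ΔMeetGen x = ∃[ a ] ∃[ b ] ∃[ y ] (IsComplement C (⟦ e ⟧ b) y × (x ≡ ⟦ e ⟧ a C.+ y))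

  IsΔ₁Extension : Set (suc ℓ)
  IsΔ₁Extension = JoinDense C ΔJoinGen × MeetDense C ΔMeetGen

  IsComplementedDMCompletion : Set (suc ℓ)
  IsComplementedDMCompletion = IsΔ₁Extension × Complete C × Complemented C

  Image : C.Carrier → Set ℓ
  Image x = ∃[ a ] (x ≡ ⟦ e ⟧ a)

  IsDMCompletion : Set (suc ℓ)
  IsDMCompletion = JoinDense C Image × MeetDense C Image

{-# OPTIONS --safe #-}
-- Both Ā and A^Δ are Δ₁-extensions of A, so each is join generated by the
-- elements a ⊙ b = ι(a) · ∼ι(b) and meet generated by a ⊕ b = ι(a) + ∼ι(b).
-- In a complemented bimonoid x · v ≤ w iff x ≤ w + ∼v, so a ⊙ b ≤ a′ ⊕ b′
-- holds iff a · b′ ≤ a′ + b in A: the order between generators is the same in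
-- Ā and in A^Δ.  Hence ι₂ x := ⋁ {a ⊙ b | a ⊙ b ≤ x in Ā} is an order
-- embedding with ι₂ ∘ ι₁ = ι; it preserves ∼ and products because products
-- of generators are generators, and sums by De Morgan.  Any other such
-- embedding sends generators to generators, so it agrees with ι₂.
module Submission where

open import Defs
open import Level using (Level)
open import Data.Product using (_×_; Σ-syntax; ∃-syntax; _,_; proj₁; proj₂)
open import Function using (_∘_)
open import Relation.Binary.PropositionalEquality using (_≡_; refl; sym; trans; cong; cong₂; module ≡-Reasoning)
open import Relation.Binary.Bundles using (Poset)
open import Relation.Binary.Structures using (IsPartialOrder)
open import Algebra.Bundles using (CommutativeMonoid)
open import Algebra.Structures using (IsCommutativeMonoid)
import Algebra.Properties.CommutativeSemigroup as CommutativeSemigroupProperties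
import Relation.Binary.Reasoning.PartialOrder as PartialOrderReasoning

module BimonoidProperties {ℓ : Level} (C : CBimonoid ℓ) where
  open CBimonoid C public
  open IsPartialOrder isPartialOrder public
    using ()
    renaming (refl to ≤-refl; trans to ≤-trans; antisym to ≤-antisym;
              ≲-respˡ-≈ to ≤-respˡ-≡; ≲-respʳ-≈ to ≤-respʳ-≡)
  open IsCommutativeMonoid ·-isCommutativeMonoid public
    using () renaming (assoc to ·-assoc; comm to ·-comm; identityʳ to ·-identityʳ)
  open IsCommutativeMonoid +-isCommutativeMonoid public
    using () renaming (assoc to +-assoc; comm to +-comm; identityˡ to +-identityˡ; identityʳ to +-identityʳ)

  poset : Poset ℓ ℓ ℓ
  poset = record { Carrier = Carrier ; _≈_ = _≡_ ; _≤_ = _≤_ ; isPartialOrder = isPartialOrder }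

  ·-commutativeMonoid : CommutativeMonoid ℓ ℓ
  ·-commutativeMonoid = record
    { Carrier = Carrier ; _≈_ = _≡_ ; _∙_ = _·_ ; ε = 1#
    ; isCommutativeMonoid = ·-isCommutativeMonoid }

  open CommutativeSemigroupProperties (CommutativeMonoid.commutativeSemigroup ·-commutativeMonoid)
    public using (interchange; xy∙z≈xz∙y)
  open PartialOrderReasoning poset

  ·-mono-≤ : ∀ {x x′ y y′} → x ≤ x′ → y ≤ y′ → x · y ≤ x′ · y′
  ·-mono-≤ {x′ = x′} {y = y} x≤x′ y≤y′ = ≤-trans (·-monoˡ y x≤x′) (·-monoʳ x′ y≤y′)

  -- By hemidistributivity, a complement v̄ of v makes  _· v  and  _+ v̄  adjoint.
  module _ {v v̄ : Carrier} (v̄-isComplement : IsComplement C v v̄) where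

    ·≤⇒≤+ : ∀ {u w} → u · v ≤ w → u ≤ w + v̄
    ·≤⇒≤+ {u} {w} uv≤w = begin
      u             ≡⟨ ·-identityʳ u ⟨
      u · 1#        ≤⟨ ·-monoʳ u (proj₂ v̄-isComplement) ⟩
      u · (v + v̄)   ≤⟨ hemiˡ u v v̄ ⟩
      u · v + v̄     ≤⟨ +-monoˡ v̄ uv≤w ⟩
      w + v̄         ∎

    ≤+⇒·≤ : ∀ {u w} → u ≤ w + v̄ → u · v ≤ w
    ≤+⇒·≤ {u} {w} u≤w+v̄ = begin
      u · v         ≤⟨ ·-monoˡ v u≤w+v̄ ⟩
      (w + v̄) · v   ≤⟨ hemiʳ v v̄ w ⟩
      w + v̄ · v     ≡⟨ cong (w +_) (·-comm v̄ v) ⟩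
      w + v · v̄     ≤⟨ +-monoʳ w (proj₁ v̄-isComplement) ⟩
      w + 0#        ≡⟨ +-identityʳ w ⟩
      w             ∎

  IsComplement-sym : ∀ {x y} → IsComplement C x y → IsComplement C y x
  IsComplement-sym {x} {y} (xy≤0 , 1≤x+y) =
    ≤-respˡ-≡ (·-comm x y) xy≤0 , ≤-respʳ-≡ (+-comm x y) 1≤x+y

  ≤-complement : ∀ {x y y′} → IsComplement C x y → IsComplement C x y′ → y ≤ y′
  ≤-complement {x} {y} {y′} y-compl y′-compl =
    ≤-respʳ-≡ (+-identityˡ y′) (·≤⇒≤+ y′-compl (≤-respˡ-≡ (·-comm x y) (proj₁ y-compl)))

  IsComplement-unique : ∀ {x y y′} → IsComplement C x y → IsComplement C x y′ → y ≡ y′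
  IsComplement-unique y-compl y′-compl =
    ≤-antisym (≤-complement y-compl y′-compl) (≤-complement y′-compl y-compl)

  IsComplement-· : ∀ {x x̄ y ȳ} → IsComplement C x x̄ → IsComplement C y ȳ →
                   IsComplement C (x · y) (x̄ + ȳ)
  IsComplement-· {x} {x̄} {y} {ȳ} x̄-compl ȳ-compl = xy⟨x̄+ȳ⟩≤0 , 1≤xy+⟨x̄+ȳ⟩
    where
    xy⟨x̄+ȳ⟩≤0 : x · y · (x̄ + ȳ) ≤ 0#
    xy⟨x̄+ȳ⟩≤0 = begin
      x · y · (x̄ + ȳ)     ≡⟨ ·-assoc x y (x̄ + ȳ) ⟩
      x · (y · (x̄ + ȳ))   ≡⟨ cong (λ t → x · (y · t)) (+-comm x̄ ȳ) ⟩
      x · (y · (ȳ + x̄))   ≤⟨ ·-monoʳ x (hemiˡ y ȳ x̄) ⟩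
      x · (y · ȳ + x̄)     ≤⟨ ·-monoʳ x (+-monoˡ x̄ (proj₁ ȳ-compl)) ⟩
      x · (0# + x̄)        ≡⟨ cong (x ·_) (+-identityˡ x̄) ⟩
      x · x̄               ≤⟨ proj₁ x̄-compl ⟩
      0#                  ∎
    1≤xy+⟨x̄+ȳ⟩ : 1# ≤ x · y + (x̄ + ȳ)
    1≤xy+⟨x̄+ȳ⟩ = begin
      1#                  ≤⟨ proj₂ x̄-compl ⟩
      x + x̄               ≤⟨ +-monoˡ x̄ (·≤⇒≤+ ȳ-compl ≤-refl) ⟩
      x · y + ȳ + x̄       ≡⟨ +-assoc (x · y) ȳ x̄ ⟩
      x · y + (ȳ + x̄)     ≡⟨ cong (x · y +_) (+-comm ȳ x̄) ⟩
      x · y + (x̄ + ȳ)     ∎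

module Complementation {ℓ : Level} (C : CBimonoid ℓ) (complemented : Complemented C) where
  open BimonoidProperties C

  infix 9 ∼_
  ∼_ : Carrier → Carrier
  ∼ x = proj₁ (complemented x)

  ∼-isComplement : ∀ x → IsComplement C x (∼ x)
  ∼-isComplement x = proj₂ (complemented x)

  ∼-isComplement-sym : ∀ x → IsComplement C (∼ x) x
  ∼-isComplement-sym x = IsComplement-sym (∼-isComplement x)

  ∼-unique : ∀ {x y} → IsComplement C x y → ∼ x ≡ y
  ∼-unique = IsComplement-unique (∼-isComplement _)

  ∼-involutive : ∀ x → ∼ ∼ x ≡ x
  ∼-involutive x = ∼-unique (∼-isComplement-sym x)

  ∼-· : ∀ x y → ∼ (x · y) ≡ ∼ x + ∼ y
  ∼-· x y = ∼-unique (IsComplement-· (∼-isComplement x) (∼-isComplement y))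

  +-deMorgan : ∀ x y → x + y ≡ ∼ (∼ x · ∼ y)
  +-deMorgan x y = sym (∼-unique (IsComplement-· (∼-isComplement-sym x) (∼-isComplement-sym y)))

  ∼-+ : ∀ x y → ∼ (x + y) ≡ ∼ x · ∼ y
  ∼-+ x y = trans (cong ∼_ (+-deMorgan x y)) (∼-involutive (∼ x · ∼ y))

  ≤∼⇒≤∼ : ∀ {u v} → u ≤ ∼ v → v ≤ ∼ u
  ≤∼⇒≤∼ {u} {v} u≤∼v =
    ≤-respʳ-≡ (+-identityˡ (∼ u)) (·≤⇒≤+ (∼-isComplement u) (≤-respˡ-≡ (·-comm u v)
      (≤+⇒·≤ (∼-isComplement v) (≤-respʳ-≡ (sym (+-identityˡ (∼ v))) u≤∼v))))

module _ {ℓ : Level} {B C : CBimonoid ℓ} (j : Embedding B C) where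
  private
    module B = BimonoidProperties B
    module C = BimonoidProperties C
    module j = Embedding j

  Embedding-preserves-IsComplement : ∀ {x y} → IsComplement B x y →
                                     IsComplement C (⟦ j ⟧ x) (⟦ j ⟧ y)
  Embedding-preserves-IsComplement {x} {y} (xy≤0 , 1≤x+y) =
    C.≤-respˡ-≡ (j.hom-· x y) (C.≤-respʳ-≡ j.hom-0 (j.mono xy≤0)) ,
    C.≤-respʳ-≡ (j.hom-+ x y) (C.≤-respˡ-≡ j.hom-1 (j.mono 1≤x+y))

  ⟦⟧-∼ : (complementedB : Complemented B) (complementedC : Complemented C) → ∀ x →
         ⟦ j ⟧ (Complementation.∼_ B complementedB x) ≡ Complementation.∼_ C complementedC (⟦ j ⟧ x)
  ⟦⟧-∼ complementedB complementedC x =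
    sym (C∼.∼-unique (Embedding-preserves-IsComplement (B∼.∼-isComplement x)))
    where
    module B∼ = Complementation B complementedB
    module C∼ = Complementation C complementedC

module Generators {ℓ : Level} {A C : CBimonoid ℓ} (e : Embedding A C) (complemented : Complemented C) where
  open BimonoidProperties C public
  open Complementation C complemented public
  open PartialOrderReasoning poset
  private
    module A = CBimonoid A
    module e = Embedding e
    ι : A.Carrier → Carrier
    ι = ⟦ e ⟧

  infix 8 _⊙_ _⊕_
  _⊙_ : A.Carrier → A.Carrier → Carrier
  a ⊙ b = ι a · ∼ ι b

  _⊕_ : A.Carrier → A.Carrier → Carrier
  a ⊕ b = ι a + ∼ ι b

  ⊙≤⊕⇒·≤+ : ∀ {a b a′ b′} → a ⊙ b ≤ a′ ⊕ b′ → a A.· b′ A.≤ a′ A.+ b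
  ⊙≤⊕⇒·≤+ {a} {b} {a′} {b′} a⊙b≤a′⊕b′ = e.reflect (begin
    ι (a A.· b′)    ≡⟨ e.hom-· a b′ ⟩
    ι a · ι b′      ≤⟨ ·≤⇒≤+ (∼-isComplement-sym (ι b)) (begin
        ι a · ι b′ · ∼ ι b   ≡⟨ xy∙z≈xz∙y (ι a) (ι b′) (∼ ι b) ⟩
        a ⊙ b · ι b′         ≤⟨ ≤+⇒·≤ (∼-isComplement (ι b′)) a⊙b≤a′⊕b′ ⟩
        ι a′                 ∎) ⟩
    ι a′ + ι b      ≡⟨ e.hom-+ a′ b ⟨
    ι (a′ A.+ b)    ∎)

  ·≤+⇒⊙≤⊕ : ∀ {a b a′ b′} → a A.· b′ A.≤ a′ A.+ b → a ⊙ b ≤ a′ ⊕ b′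
  ·≤+⇒⊙≤⊕ {a} {b} {a′} {b′} ab′≤a′+b = ·≤⇒≤+ (∼-isComplement (ι b′)) (begin
    a ⊙ b · ι b′          ≡⟨ xy∙z≈xz∙y (ι a) (∼ ι b) (ι b′) ⟩
    ι a · ι b′ · ∼ ι b    ≤⟨ ≤+⇒·≤ (∼-isComplement-sym (ι b)) (begin
        ι a · ι b′     ≡⟨ e.hom-· a b′ ⟨
        ι (a A.· b′)   ≤⟨ e.mono ab′≤a′+b ⟩
        ι (a′ A.+ b)   ≡⟨ e.hom-+ a′ b ⟩
        ι a′ + ι b     ∎) ⟩
    ι a′                  ∎)

  ⊙≤ι⇒≤+ : ∀ {a a′ b′} → a′ ⊙ b′ ≤ ι a → a′ A.≤ a A.+ b′
  ⊙≤ι⇒≤+ {a} {a′} {b′} a′⊙b′≤ιa =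
    e.reflect (≤-respʳ-≡ (sym (e.hom-+ a b′)) (·≤⇒≤+ (∼-isComplement-sym (ι b′)) a′⊙b′≤ιa))

  ≤+⇒⊙≤ι : ∀ {a a′ b′} → a′ A.≤ a A.+ b′ → a′ ⊙ b′ ≤ ι a
  ≤+⇒⊙≤ι {a} {a′} {b′} a′≤a+b′ =
    ≤+⇒·≤ (∼-isComplement-sym (ι b′)) (≤-respʳ-≡ (e.hom-+ a b′) (e.mono a′≤a+b′))

  ⊙-·-⊙ : ∀ a b a′ b′ → a ⊙ b · a′ ⊙ b′ ≡ (a A.· a′) ⊙ (b A.+ b′)
  ⊙-·-⊙ a b a′ b′ = begin-equality
    a ⊙ b · a′ ⊙ b′                ≡⟨ interchange (ι a) (∼ ι b) (ι a′) (∼ ι b′) ⟩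
    ι a · ι a′ · (∼ ι b · ∼ ι b′)  ≡⟨ cong₂ _·_ (e.hom-· a a′) (∼-+ (ι b) (ι b′)) ⟨
    ι (a A.· a′) · ∼ (ι b + ι b′)  ≡⟨ cong (λ t → ι (a A.· a′) · ∼ t) (e.hom-+ b b′) ⟨
    (a A.· a′) ⊙ (b A.+ b′)        ∎

  ∼-⊙ : ∀ a b → ∼ (a ⊙ b) ≡ b ⊕ a
  ∼-⊙ a b = begin-equality
    ∼ (ι a · ∼ ι b)     ≡⟨ ∼-· (ι a) (∼ ι b) ⟩
    ∼ ι a + ∼ ∼ ι b     ≡⟨ cong (∼ ι a +_) (∼-involutive (ι b)) ⟩
    ∼ ι a + ι b         ≡⟨ +-comm (∼ ι a) (ι b) ⟩
    b ⊕ a               ∎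

  ΔJoinGen⇒⊙ : ∀ {z} → ΔJoinGen e z → ∃[ a ] ∃[ b ] z ≡ a ⊙ b
  ΔJoinGen⇒⊙ (a , b , y , y-compl , z≡ιa·y) = a , b , trans z≡ιa·y (cong (ι a ·_) (sym (∼-unique y-compl)))

  ΔMeetGen⇒⊕ : ∀ {z} → ΔMeetGen e z → ∃[ a ] ∃[ b ] z ≡ a ⊕ b
  ΔMeetGen⇒⊕ (a , b , y , y-compl , z≡ιa+y) = a , b , trans z≡ιa+y (cong (ι a +_) (sym (∼-unique y-compl)))

module Δ₁Extension {ℓ : Level} {A C : CBimonoid ℓ} (e : Embedding A C)
                   (complemented : Complemented C) (Δ₁ : IsΔ₁Extension e) where
  open Generators e complemented public

  ≤-by-⊙ : ∀ {x u} → (∀ a b → a ⊙ b ≤ x → a ⊙ b ≤ u) → x ≤ u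
  ≤-by-⊙ {x} {u} below⇒below with proj₁ Δ₁ x
  ... | S , S⊆gen , upper , least = least u λ z z∈S → go (ΔJoinGen⇒⊙ (S⊆gen z z∈S)) (upper z z∈S)
    where
    go : ∀ {z} → ∃[ a ] ∃[ b ] z ≡ a ⊙ b → z ≤ x → z ≤ u
    go (a , b , refl) = below⇒below a b

  ≥-by-⊕ : ∀ {x u} → (∀ a b → x ≤ a ⊕ b → u ≤ a ⊕ b) → u ≤ x
  ≥-by-⊕ {x} {u} above⇒above with proj₂ Δ₁ x
  ... | S , S⊆gen , lower , greatest = greatest u λ z z∈S → go (ΔMeetGen⇒⊕ (S⊆gen z z∈S)) (lower z z∈S)
    where
    go : ∀ {z} → ∃[ a ] ∃[ b ] z ≡ a ⊕ b → x ≤ z → u ≤ z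
    go (a , b , refl) = above⇒above a b

  ·≤-by-⊙ˡ : ∀ {x y m} → (∀ a b → a ⊙ b ≤ x → a ⊙ b · y ≤ m) → x · y ≤ m
  ·≤-by-⊙ˡ {y = y} bound =
    ≤+⇒·≤ (∼-isComplement y) (≤-by-⊙ λ a b a⊙b≤x → ·≤⇒≤+ (∼-isComplement y) (bound a b a⊙b≤x))

  ·≤-by-⊙ : ∀ {x y m} → (∀ a b a′ b′ → a ⊙ b ≤ x → a′ ⊙ b′ ≤ y → a ⊙ b · a′ ⊙ b′ ≤ m) →
            x · y ≤ m
  ·≤-by-⊙ {y = y} bound = ·≤-by-⊙ˡ λ a b a⊙b≤x →
    ≤-respˡ-≡ (·-comm y (a ⊙ b)) (·≤-by-⊙ˡ λ a′ b′ a′⊙b′≤y →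
      ≤-respˡ-≡ (·-comm (a ⊙ b) (a′ ⊙ b′)) (bound a b a′ b′ a⊙b≤x a′⊙b′≤y))

-- The order between generators is computed in A, hence agrees in any two complemented extensions.
module GeneratorTransfer {ℓ : Level} {A C C′ : CBimonoid ℓ}
                         (e : Embedding A C) (complementedC : Complemented C)
                         (e′ : Embedding A C′) (complementedC′ : Complemented C′) where
  private
    module C = Generators e complementedC
    module C′ = Generators e′ complementedC′

  ⊙≤⊕ : ∀ {a b a′ b′} → a C.⊙ b C.≤ a′ C.⊕ b′ → a C′.⊙ b C′.≤ a′ C′.⊕ b′
  ⊙≤⊕ = C′.·≤+⇒⊙≤⊕ ∘ C.⊙≤⊕⇒·≤+

  ⊙≤ι : ∀ {a a′ b′} → a′ C.⊙ b′ C.≤ ⟦ e ⟧ a → a′ C′.⊙ b′ C′.≤ ⟦ e′ ⟧ a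
  ⊙≤ι = C′.≤+⇒⊙≤ι ∘ C.⊙≤ι⇒≤+

  ⊙·⊙≤⊕ : ∀ {a₁ b₁ a₂ b₂ a b} → a₁ C.⊙ b₁ C.· a₂ C.⊙ b₂ C.≤ a C.⊕ b →
          a₁ C′.⊙ b₁ C′.· a₂ C′.⊙ b₂ C′.≤ a C′.⊕ b
  ⊙·⊙≤⊕ {a₁} {b₁} {a₂} {b₂} =
    C′.≤-respˡ-≡ (sym (C′.⊙-·-⊙ a₁ b₁ a₂ b₂)) ∘ ⊙≤⊕ ∘ C.≤-respˡ-≡ (C.⊙-·-⊙ a₁ b₁ a₂ b₂)

module _ {ℓ : Level} {C : CBimonoid ℓ} {P Q : CBimonoid.Carrier C → Set ℓ} (P⊆Q : ∀ x → P x → Q x) where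

  JoinDense-mono : JoinDense C P → JoinDense C Q
  JoinDense-mono dense c with dense c
  ... | S , S⊆P , lub = S , (λ x → P⊆Q x ∘ S⊆P x) , lub

  MeetDense-mono : MeetDense C P → MeetDense C Q
  MeetDense-mono dense c with dense c
  ... | S , S⊆P , glb = S , (λ x → P⊆Q x ∘ S⊆P x) , glb

module Completion {ℓ : Level} {A Ā AΔ : CBimonoid ℓ}
                  (ι₁ : Embedding A Ā) (Δ₁ : IsΔ₁Extension ι₁) (complementedĀ : Complemented Ā)
                  (ι : Embedding A AΔ) (cdm : IsComplementedDMCompletion ι) where
  private
    module A = CBimonoid A
    module ι₁ = Embedding ι₁
    module ι = Embedding ι
    complementedΔ : Complemented AΔ
    complementedΔ = proj₂ (proj₂ cdm)
    joins : ∀ S → ∃[ s ] IsLUB AΔ S s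
    joins = proj₁ (proj₁ (proj₂ cdm))
    module Ā = Δ₁Extension ι₁ complementedĀ Δ₁
    module Δ = Δ₁Extension ι complementedΔ (proj₁ cdm)
    module Ā⇒Δ = GeneratorTransfer ι₁ complementedĀ ι complementedΔ
    module Δ⇒Ā = GeneratorTransfer ι complementedΔ ι₁ complementedĀ

  ⊙-below : Ā.Carrier → Δ.Carrier → Set ℓ
  ⊙-below x z = ∃[ a ] ∃[ b ] (z ≡ a Δ.⊙ b) × (a Ā.⊙ b Ā.≤ x)

  φ : Ā.Carrier → Δ.Carrier
  φ x = proj₁ (joins (⊙-below x))

  φ-isLUB : ∀ x → IsLUB AΔ (⊙-below x) (φ x)
  φ-isLUB x = proj₂ (joins (⊙-below x))

  ⊙≤⇒⊙≤φ : ∀ {x a b} → a Ā.⊙ b Ā.≤ x → a Δ.⊙ b Δ.≤ φ x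
  ⊙≤⇒⊙≤φ {x} {a} {b} a⊙b≤x = proj₁ (φ-isLUB x) _ (a , b , refl , a⊙b≤x)

  ≤⊕⇒φ≤⊕ : ∀ {x a b} → x Ā.≤ a Ā.⊕ b → φ x Δ.≤ a Δ.⊕ b
  ≤⊕⇒φ≤⊕ {x} x≤a⊕b = proj₂ (φ-isLUB x) _ λ { _ (a′ , b′ , refl , a′⊙b′≤x) →
    Ā⇒Δ.⊙≤⊕ (Ā.≤-trans a′⊙b′≤x x≤a⊕b) }

  φ≤⊕⇒≤⊕ : ∀ {x a b} → φ x Δ.≤ a Δ.⊕ b → x Ā.≤ a Ā.⊕ b
  φ≤⊕⇒≤⊕ φx≤a⊕b = Ā.≤-by-⊙ λ a′ b′ a′⊙b′≤x → Δ⇒Ā.⊙≤⊕ (Δ.≤-trans (⊙≤⇒⊙≤φ a′⊙b′≤x) φx≤a⊕b)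

  ⊙≤φ⇒⊙≤ : ∀ {x a b} → a Δ.⊙ b Δ.≤ φ x → a Ā.⊙ b Ā.≤ x
  ⊙≤φ⇒⊙≤ a⊙b≤φx = Ā.≥-by-⊕ λ a′ b′ x≤a′⊕b′ → Δ⇒Ā.⊙≤⊕ (Δ.≤-trans a⊙b≤φx (≤⊕⇒φ≤⊕ x≤a′⊕b′))

  φ-mono : ∀ {x y} → x Ā.≤ y → φ x Δ.≤ φ y
  φ-mono x≤y = Δ.≤-by-⊙ λ a b a⊙b≤φx → ⊙≤⇒⊙≤φ (Ā.≤-trans (⊙≤φ⇒⊙≤ a⊙b≤φx) x≤y)

  φ-reflect : ∀ {x y} → φ x Δ.≤ φ y → x Ā.≤ y
  φ-reflect φx≤φy = Ā.≤-by-⊙ λ a b a⊙b≤x → ⊙≤φ⇒⊙≤ (Δ.≤-trans (⊙≤⇒⊙≤φ a⊙b≤x) φx≤φy)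

  φ-ι₁ : ∀ a → φ (⟦ ι₁ ⟧ a) ≡ ⟦ ι ⟧ a
  φ-ι₁ a = Δ.≤-antisym
    (Δ.≤-by-⊙ λ a′ b′ a′⊙b′≤φι₁a → Ā⇒Δ.⊙≤ι (⊙≤φ⇒⊙≤ a′⊙b′≤φι₁a))
    (Δ.≤-by-⊙ λ a′ b′ a′⊙b′≤ιa → ⊙≤⇒⊙≤φ (Δ⇒Ā.⊙≤ι a′⊙b′≤ιa))

  φ-· : ∀ x y → φ (x Ā.· y) ≡ φ x Δ.· φ y
  φ-· x y = Δ.≤-antisym
    (Δ.≥-by-⊕ λ a b φxφy≤a⊕b → ≤⊕⇒φ≤⊕ (Ā.·≤-by-⊙ λ _ _ _ _ p q →
      Δ⇒Ā.⊙·⊙≤⊕ (Δ.≤-trans (Δ.·-mono-≤ (⊙≤⇒⊙≤φ p) (⊙≤⇒⊙≤φ q)) φxφy≤a⊕b)))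
    (Δ.≥-by-⊕ λ a b φxy≤a⊕b → Δ.·≤-by-⊙ λ _ _ _ _ p q →
      Ā⇒Δ.⊙·⊙≤⊕ (Ā.≤-trans (Ā.·-mono-≤ (⊙≤φ⇒⊙≤ p) (⊙≤φ⇒⊙≤ q)) (φ≤⊕⇒≤⊕ φxy≤a⊕b)))

  φ-∼ : ∀ x → φ (Ā.∼ x) ≡ Δ.∼ φ x
  φ-∼ x = Δ.≤-antisym
    (Δ.≤-by-⊙ λ a b a⊙b≤φ∼x → Δ.≤∼⇒≤∼ (Δ.≤-respʳ-≡ (sym (Δ.∼-⊙ a b))
      (≤⊕⇒φ≤⊕ (Ā.≤-respʳ-≡ (Ā.∼-⊙ a b) (Ā.≤∼⇒≤∼ (⊙≤φ⇒⊙≤ a⊙b≤φ∼x))))))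
    (Δ.≤-by-⊙ λ a b a⊙b≤∼φx → ⊙≤⇒⊙≤φ (Ā.≤∼⇒≤∼ (Ā.≤-respʳ-≡ (sym (Ā.∼-⊙ a b))
      (φ≤⊕⇒≤⊕ (Δ.≤-respʳ-≡ (Δ.∼-⊙ a b) (Δ.≤∼⇒≤∼ a⊙b≤∼φx))))))

  φ-+ : ∀ x y → φ (x Ā.+ y) ≡ φ x Δ.+ φ y
  φ-+ x y = begin
    φ (x Ā.+ y)                   ≡⟨ cong φ (Ā.+-deMorgan x y) ⟩
    φ (Ā.∼ (Ā.∼ x Ā.· Ā.∼ y))     ≡⟨ φ-∼ _ ⟩
    Δ.∼ φ (Ā.∼ x Ā.· Ā.∼ y)       ≡⟨ cong Δ.∼_ (φ-· _ _) ⟩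
    Δ.∼ (φ (Ā.∼ x) Δ.· φ (Ā.∼ y)) ≡⟨ cong Δ.∼_ (cong₂ Δ._·_ (φ-∼ x) (φ-∼ y)) ⟩
    Δ.∼ (Δ.∼ φ x Δ.· Δ.∼ φ y)     ≡⟨ Δ.+-deMorgan (φ x) (φ y) ⟨
    φ x Δ.+ φ y                   ∎
    where open ≡-Reasoning

  ι₂ : Embedding Ā AΔ
  ι₂ = record
    { ⟦_⟧ = φ ; mono = φ-mono ; reflect = φ-reflect ; hom-· = φ-· ; hom-+ = φ-+
    ; hom-1 = trans (cong φ (sym ι₁.hom-1)) (trans (φ-ι₁ A.1#) ι.hom-1)
    ; hom-0 = trans (cong φ (sym ι₁.hom-0)) (trans (φ-ι₁ A.0#) ι.hom-0) }

  module _ (j : Embedding Ā AΔ) (j-ι₁ : ∀ a → ⟦ j ⟧ (⟦ ι₁ ⟧ a) ≡ ⟦ ι ⟧ a) where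
    private
      module j = Embedding j

    j-∼ι₁ : ∀ b → ⟦ j ⟧ (Ā.∼ ⟦ ι₁ ⟧ b) ≡ Δ.∼ ⟦ ι ⟧ b
    j-∼ι₁ b = trans (⟦⟧-∼ j complementedĀ complementedΔ (⟦ ι₁ ⟧ b)) (cong Δ.∼_ (j-ι₁ b))

    j-⊙ : ∀ a b → ⟦ j ⟧ (a Ā.⊙ b) ≡ a Δ.⊙ b
    j-⊙ a b = trans (j.hom-· _ _) (cong₂ Δ._·_ (j-ι₁ a) (j-∼ι₁ b))

    j-⊕ : ∀ a b → ⟦ j ⟧ (a Ā.⊕ b) ≡ a Δ.⊕ b
    j-⊕ a b = trans (j.hom-+ _ _) (cong₂ Δ._+_ (j-ι₁ a) (j-∼ι₁ b))

    j≗φ : ∀ x → ⟦ j ⟧ x ≡ φ x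
    j≗φ x = Δ.≤-antisym
      (Δ.≤-by-⊙ λ a b a⊙b≤jx → ⊙≤⇒⊙≤φ (j.reflect (Δ.≤-respˡ-≡ (sym (j-⊙ a b)) a⊙b≤jx)))
      (Δ.≤-by-⊙ λ a b a⊙b≤φx → Δ.≤-respˡ-≡ (j-⊙ a b) (j.mono (⊙≤φ⇒⊙≤ a⊙b≤φx)))

  ι₂-isDMCompletion : IsDMCompletion ι₂
  ι₂-isDMCompletion =
    JoinDense-mono {C = AΔ} ⊙∈Image (proj₁ (proj₁ cdm)) , MeetDense-mono {C = AΔ} ⊕∈Image (proj₂ (proj₁ cdm))
    where
    ⊙∈Image : ∀ z → ΔJoinGen ι z → Image ι₂ z
    ⊙∈Image z gen with Δ.ΔJoinGen⇒⊙ gen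
    ... | a , b , refl = a Ā.⊙ b , sym (j-⊙ ι₂ φ-ι₁ a b)
    ⊕∈Image : ∀ z → ΔMeetGen ι z → Image ι₂ z
    ⊕∈Image z gen with Δ.ΔMeetGen⇒⊕ gen
    ... | a , b , refl = a Ā.⊕ b , sym (j-⊕ ι₂ φ-ι₁ a b)

mainTheorem7 : {ℓ : Level} (A Ā AΔ : CBimonoid ℓ)
               (ι₁ : Embedding A Ā) → IsΔ₁Extension ι₁ → Complemented Ā →
               (ι : Embedding A AΔ) → IsComplementedDMCompletion ι →
               Σ[ ι₂ ∈ Embedding Ā AΔ ]
                 ((IsDMCompletion ι₂ × (∀ a → ⟦ ι₂ ⟧ (⟦ ι₁ ⟧ a) ≡ ⟦ ι ⟧ a))
                 × (∀ (j : Embedding Ā AΔ) → IsDMCompletion j →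
                      (∀ a → ⟦ j ⟧ (⟦ ι₁ ⟧ a) ≡ ⟦ ι ⟧ a) →
                      ∀ x → ⟦ j ⟧ x ≡ ⟦ ι₂ ⟧ x))
mainTheorem7 A Ā AΔ ι₁ Δ₁ complementedĀ ι cdm =
  ι₂ , (ι₂-isDMCompletion , φ-ι₁) , λ j _ j-ι₁ → j≗φ j j-ι₁
  where open Completion ι₁ Δ₁ complementedĀ ι cdm
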